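{- Let $\mathcal{J}$ be a maximal ideal on $\mathbb{N}$ and define $\delta:\mathcal{P}(\mathbb{N})\to[0,1]$ by $\delta(A)=\lim^{\mathcal{J}}\frac{|A\cap\{1,\dots,n\}|}{n}$. Then $\mathcal{Z}_\delta=\{A\subseteq\mathbb{N}:\delta(A)=0\}$ is not a T-maximal ideal.
   Context: For $A\subseteq\mathbb{N}$ and $k\in\mathbb{Z}$, $A+k$ denotes $\{a+k:a\in A\}\cap\mathbb{N}$. An ideal on $\mathbb{N}$ is a family $\mathcal{I}\subseteq\mathcal{P}(\mathbb{N})$ closed under finite unions and subsets, containing all finite subsets of $\mathbb{N}$, with $\mathbb{N}\notin\mathcal{I}$; it is maximal if it is not properly contained in another ideal on $\mathbb{N}$, and translation invariant if $A+k\in\mathcal{I}$ for all $A\in\mathcal{I}$, $k\in\mathbb{Z}$. A translation invariant ideal $\mathcal{I}$ is T-maximal if for every translation invariant ideal $\mathcal{K}$, $\mathcal{I}\subseteq\mathcal{K}$ implies $\mathcal{I}=\mathcal{K}$. For an ideal $\mathcal{J}$, a real sequence $(x_n)$ is $\mathcal{J}$-convergent to $L$, written $L=\lim^{\mathcal{J}}x_n$, if $\{n\in\mathbb{N}:|x_n-L|\ge\varepsilon\}\in\mathcal{J}$ for every $\varepsilon>0$ (for maximal $\mathcal{J}$ every bounded sequence has a unique such limit). -}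

module Defs where

open import Data.Bool using (Bool; true; false; _∨_; if_then_else_)
open import Data.Nat using (ℕ; zero; suc; _+_; _∸_; _<_; _≤ᵇ_)
open import Data.Integer using (ℤ; +_; -[1+_])
open import Data.Rational as ℚ using (ℚ; 0ℚ)
open import Data.Product using (Σ; _×_)
open import Relation.Binary.PropositionalEquality using (_≡_)
open import Relation.Nullary using (¬_)

-- Subsets of ℕ, given by their characteristic function.
-- Convention: the Agda number m represents the paper's natural number m+1
-- (so Agda ℕ = {0,1,...} models the paper's ℕ = {1,2,...}).
Subset : Set
Subset = ℕ → Bool

_∈_ : ℕ → Subset → Set
m ∈ A = A m ≡ true

_⊆_ : Subset → Subset → Set
A ⊆ B = ∀ m → m ∈ A → m ∈ B

_∪_ : Subset → Subset → Subset
(A ∪ B) m = A m ∨ B m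

Full : Subset
Full _ = true

IsFinite : Subset → Set
IsFinite A = Σ ℕ λ N → ∀ m → m ∈ A → m < N

shift : Subset → ℤ → Subset
shift A (+ j) m = if j ≤ᵇ m then A (m ∸ j) else false
shift A -[1+ j ] m = A (m + suc j)

Family : Set₁
Family = Subset → Set

IsIdeal : Family → Set
IsIdeal I =
  (∀ A B → I A → I B → I (A ∪ B)) ×
  (∀ A B → A ⊆ B → I B → I A) ×
  (∀ A → IsFinite A → I A) ×
  ¬ I Full

IsMaximalIdeal : Family → Set₁
IsMaximalIdeal I = IsIdeal I × (∀ K → IsIdeal K → (∀ A → I A → K A) → ∀ A → K A → I A)

IsTransInv : Family → Set
IsTransInv I = ∀ A k → I A → I (shift A k)

IsTIIdeal : Family → Set
IsTIIdeal I = IsIdeal I × IsTransInv I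

IsTMaximal : Family → Set₁
IsTMaximal I = IsTIIdeal I × (∀ K → IsTIIdeal K → (∀ A → I A → K A) → ∀ A → K A → I A)

-- number of elements of A among the first k Agda-numbers (= |A ∩ {1..k}| in the paper)
count : Subset → ℕ → ℕ
count A zero = 0
count A (suc k) = (if A k then 1 else 0) + count A k

-- d A k = |A ∩ {1,…,k+1}| / (k+1)   (paper's index n = k+1)
dens : Subset → ℕ → ℚ
dens A k = (+ count A (suc k)) ℚ./ suc k

-- Z_δ = {A : δ(A) = 0}, where δ(A) = lim^J dens A; "lim^J = 0" unfolded:
-- for every ε > 0, {n : |dens A n - 0| ≥ ε} ∈ J  (dens ≥ 0, so this is ε ≤ dens A n)
Zδ : Family → Family
Zδ J A = ∀ (ε : ℚ) → 0ℚ ℚ.< ε → J (λ k → ε ℚ.≤ᵇ dens A k)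

-- Cut ℕ into the dyadic blocks [2ʲ, 2ʲ⁺¹) and let E be the union of the even
-- numbered blocks. E and its complement both have lower density at least 1/8,
-- so neither lies in Z_δ, while the set P of block endpoints has logarithmic
-- counting function and hence lies in Z_δ. As E changes only on P, every
-- (∁E + k) ∩ E is covered by finitely many translates of P, so
-- {B : B ∩ E ∈ Z_δ} is a translation invariant ideal containing Z_δ and ∁E.
module Submission where

open import Data.Bool using (Bool; true; false; T; not; _∧_; _∨_; if_then_else_)
open import Data.Bool.Properties using (T-≡; ∧-distribʳ-∨)
open import Data.Empty using (⊥-elim)
open import Data.Integer as ℤ using (+_; -[1+_]; +≤+)
import Data.Integer.Properties as ℤ
open import Data.Nat
open import Data.Nat.Properties
open import Data.Nat.Tactic.RingSolver using (solve-∀)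
open import Data.Product using (∃; _×_; _,_; proj₁; proj₂)
open import Data.Rational as ℚ using (ℚ; mkℚ; 0ℚ; toℚᵘ)
import Data.Rational.Properties as ℚ
open import Data.Rational.Unnormalised as ℚᵘ using (mkℚᵘ; *≤*)
import Data.Rational.Unnormalised.Properties as ℚᵘ
open import Data.Sum using (_⊎_; inj₁; inj₂)
open import Function using (_⇔_; mk⇔; Equivalence)
open import Relation.Binary.PropositionalEquality
open import Relation.Nullary using (¬_; yes; no)

open import Defs

open Equivalence using (to; from)

_∩_ : Subset → Subset → Subset
(A ∩ B) m = A m ∧ B m

∁ : Subset → Subset
∁ A m = not (A m)

∧-true⁻ : ∀ {x y} → x ∧ y ≡ true → x ≡ true × y ≡ true
∧-true⁻ {true} {true} _ = refl , refl

false≢true : false ≢ true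
false≢true ()

not-true : ∀ {x} → not x ≡ true → x ≡ false
not-true {false} _ = refl

∧-intro : ∀ {x y} → x ≡ true → y ≡ true → x ∧ y ≡ true
∧-intro refl refl = refl

∨-introˡ : ∀ {x y} → x ≡ true → x ∨ y ≡ true
∨-introˡ refl = refl

∨-introʳ : ∀ {x y} → y ≡ true → x ∨ y ≡ true
∨-introʳ {true}  _ = refl
∨-introʳ {false} h = h

∩-⊆ˡ : ∀ A B → (A ∩ B) ⊆ A
∩-⊆ˡ A B m h = proj₁ (∧-true⁻ h)

∩-monoˡ-⊆ : ∀ {A B} C → A ⊆ B → (A ∩ C) ⊆ (B ∩ C)
∩-monoˡ-⊆ C A⊆B m h with ∧-true⁻ h
... | a , c rewrite A⊆B m a | c = refl

∁-∩-empty : ∀ A m → ¬ m ∈ (∁ A ∩ A)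
∁-∩-empty A m h with A m | h
... | true  | ()
... | false | ()

shift-cases : ∀ k m → (∀ A → shift A k m ≡ false) ⊎ ∃ λ p → ∀ A → shift A k m ≡ A p
shift-cases (+ j) m with j ≤ᵇ m
... | true  = inj₂ (m ∸ j , λ _ → refl)
... | false = inj₁ (λ _ → refl)
shift-cases -[1+ j ] m = inj₂ (m + suc j , λ _ → refl)

shift-suc : ∀ A j m → shift A (+ suc j) (suc m) ≡ shift A (+ j) m
shift-suc A zero    m = refl
shift-suc A (suc j) m = refl

AlmostInvariant : Family → Subset → Set
AlmostInvariant Z E = ∀ k → Z (shift (∁ E) k ∩ E)

module Ideal {Z : Family} (Z-ideal : IsIdeal Z) where

  ∪-closed : ∀ A B → Z A → Z B → Z (A ∪ B)
  ∪-closed = proj₁ Z-ideal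

  ⊆-closed : ∀ {A B} → A ⊆ B → Z B → Z A
  ⊆-closed {A} {B} = proj₁ (proj₂ Z-ideal) A B

  finite : ∀ A → IsFinite A → Z A
  finite = proj₁ (proj₂ (proj₂ Z-ideal))

  ¬Full : ¬ Z Full
  ¬Full = proj₂ (proj₂ (proj₂ Z-ideal))

module TIIdeal {Z : Family} (Z-ideal : IsTIIdeal Z) where

  open Ideal (proj₁ Z-ideal)

  transInv : IsTransInv Z
  transInv = proj₂ Z-ideal

  -- Induction on |k|, peeling off one unit step of the translation: where E
  -- changes across that step, the point is a translate of a point of P.
  almostInvariant : ∀ E P → Z P → (∀ m → E m ≢ E (suc m) → m ∈ P) → AlmostInvariant Z E
  almostInvariant E P P∈Z changes⊆P = invariant
    where
    up : ∀ j → (shift (∁ E) (+ suc j) ∩ E) ⊆ (shift (shift (∁ E) (+ j) ∩ E) (+ 1) ∪ shift P (+ 1))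
    up j zero    ()
    up j (suc m) h with ∧-true⁻ (subst (λ x → x ∧ E (suc m) ≡ true) (shift-suc (∁ E) j m) h) | E m in e
    ... | outside , _      | true  = ∨-introˡ (∧-intro outside refl)
    ... | _       , inside | false = ∨-introʳ (changes⊆P m λ eq → false≢true (trans (sym e) (trans eq inside)))

    down₀ : (shift (∁ E) -[1+ 0 ] ∩ E) ⊆ P
    down₀ m h with ∧-true⁻ h
    ... | outside , inside = changes⊆P m λ eq → false≢true
                               (trans (sym (not-true outside)) (trans (cong E (+-comm m 1)) (trans (sym eq) inside)))

    down : ∀ j → (shift (∁ E) -[1+ suc j ] ∩ E) ⊆ ((shift (∁ E) -[1+ j ] ∩ E) ∪ shift P -[1+ j ])
    down j m h with ∧-true⁻ h | E (m + suc j) in e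
    ... | _       , inside | false = ∨-introˡ inside
    ... | outside , _      | true  = changes⊆P (m + suc j) λ eq → false≢true
                                       (trans (sym (not-true outside)) (trans (cong E (+-suc m (suc j))) (trans (sym eq) e)))

    invariant : AlmostInvariant Z E
    invariant (+ zero)     = finite _ (0 , λ m h → ⊥-elim (∁-∩-empty E m h))
    invariant (+ suc j)    =
      ⊆-closed (up j) (∪-closed _ _ (transInv _ (+ 1) (invariant (+ j))) (transInv P (+ 1) P∈Z))
    invariant -[1+ zero ]  = ⊆-closed down₀ P∈Z
    invariant -[1+ suc j ] =
      ⊆-closed (down j) (∪-closed _ _ (invariant -[1+ j ]) (transInv P -[1+ j ] P∈Z))

  module Trace {E : Subset} (E∉Z : ¬ Z E) (E-almostInv : AlmostInvariant Z E) where

    trace : Family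
    trace B = Z (B ∩ E)

    trace-isTIIdeal : IsTIIdeal trace
    trace-isTIIdeal = (∪-closedᵗ , ⊆-closedᵗ , finiteᵗ , ¬Fullᵗ) , transInvᵗ
      where
      ∪-closedᵗ : ∀ A B → trace A → trace B → trace (A ∪ B)
      ∪-closedᵗ A B A∈ B∈ =
        ⊆-closed (λ m h → trans (sym (∧-distribʳ-∨ (E m) (A m) (B m))) h) (∪-closed _ _ A∈ B∈)

      ⊆-closedᵗ : ∀ A B → A ⊆ B → trace B → trace A
      ⊆-closedᵗ A B A⊆B = ⊆-closed (∩-monoˡ-⊆ E A⊆B)

      finiteᵗ : ∀ A → IsFinite A → trace A
      finiteᵗ A (N , bounded) = finite _ (N , λ m h → bounded m (∩-⊆ˡ A E m h))

      ¬Fullᵗ : ¬ trace Full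
      ¬Fullᵗ Full∈ = E∉Z (⊆-closed (λ m h → h) Full∈)

      transInvᵗ : IsTransInv trace
      transInvᵗ B k B∈ = ⊆-closed split (∪-closed _ _ (transInv _ k B∈) (E-almostInv k))
        where
        split : ∀ m → m ∈ (shift B k ∩ E) → m ∈ (shift (B ∩ E) k ∪ (shift (∁ E) k ∩ E))
        split m h with shift-cases k m
        ... | inj₁ empty = ⊥-elim (false≢true (trans (sym (cong (_∧ E m) (empty B))) h))
        ... | inj₂ (p , at-p) rewrite at-p (B ∩ E) | at-p (∁ E) =
          recombine (E p) (∧-true⁻ (subst (λ x → x ∧ E m ≡ true) (at-p B) h))
          where
          recombine : ∀ e → B p ≡ true × E m ≡ true → (B p ∧ e) ∨ (not e ∧ E m) ≡ true
          recombine true  (b , _) = ∨-introˡ (∧-intro b refl)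
          recombine false (_ , e) = ∨-introʳ e

    Z⊆trace : ∀ A → Z A → trace A
    Z⊆trace A = ⊆-closed (∩-⊆ˡ A E)

    ∁-∈-trace : trace (∁ E)
    ∁-∈-trace = finite _ (0 , λ m h → ⊥-elim (∁-∩-empty E m h))

¬IsTMaximal-if-almostInvariant : ∀ {Z} E → ¬ Z E → ¬ Z (∁ E) → AlmostInvariant Z E → ¬ IsTMaximal Z
¬IsTMaximal-if-almostInvariant E E∉Z ∁E∉Z E-almostInv (Z-ideal , maximal) =
  ∁E∉Z (maximal trace trace-isTIIdeal Z⊆trace (∁ E) ∁-∈-trace)
  where open TIIdeal.Trace Z-ideal E∉Z E-almostInv

toℚᵘ-fraction : ∀ a k → toℚᵘ ((+ a) ℚ./ suc k) ℚᵘ.≃ mkℚᵘ (+ a) k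
toℚᵘ-fraction a k = ℚ.toℚᵘ-fromℚᵘ (mkℚᵘ (+ a) k)

≤ᵇ-fraction⇔ : ∀ ε a k → T (ε ℚ.≤ᵇ (+ a) ℚ./ suc k) ⇔ toℚᵘ ε ℚᵘ.≤ mkℚᵘ (+ a) k
≤ᵇ-fraction⇔ ε a k = mk⇔
  (λ le → ℚᵘ.≤-respʳ-≃ (toℚᵘ-fraction a k) (ℚ.toℚᵘ-mono-≤ (ℚ.≤ᵇ⇒≤ le)))
  (λ le → ℚ.≤⇒≤ᵇ (ℚ.toℚᵘ-cancel-≤ (ℚᵘ.≤-respʳ-≃ (ℚᵘ.≃-sym (toℚᵘ-fraction a k)) le)))

mkℚᵘ-≤⇔ : ∀ a b c d → mkℚᵘ (+ a) b ℚᵘ.≤ mkℚᵘ (+ c) d ⇔ a * suc d ≤ c * suc b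
mkℚᵘ-≤⇔ a b c d = mk⇔
  (λ { (*≤* le) → ℤ.drop‿+≤+ (subst₂ ℤ._≤_ (sym (ℤ.pos-* a (suc d))) (sym (ℤ.pos-* c (suc b))) le) })
  (λ le → *≤* (subst₂ ℤ._≤_ (ℤ.pos-* a (suc d)) (ℤ.pos-* c (suc b)) (+≤+ le)))

≤ᵇ-fraction⇒ : ∀ ε → 0ℚ ℚ.< ε → ∃ λ q → ∀ a k → T (ε ℚ.≤ᵇ (+ a) ℚ./ suc k) → suc k ≤ q * a
≤ᵇ-fraction⇒ (mkℚ (+ zero)   d _) (ℚ.*<* (ℤ.+<+ ()))
≤ᵇ-fraction⇒ (mkℚ -[1+ n ]    d _) (ℚ.*<* ())
≤ᵇ-fraction⇒ (mkℚ (+ suc n) d c) _ = suc d , bound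
  where
  bound : ∀ a k → T (mkℚ (+ suc n) d c ℚ.≤ᵇ (+ a) ℚ./ suc k) → suc k ≤ suc d * a
  bound a k le = begin
    suc k            ≤⟨ m≤n*m (suc k) (suc n) ⟩
    suc n * suc k    ≤⟨ to (mkℚᵘ-≤⇔ (suc n) d a k) (to (≤ᵇ-fraction⇔ (mkℚ (+ suc n) d c) a k) le) ⟩
    a * suc d        ≡⟨ *-comm a (suc d) ⟩
    suc d * a        ∎
    where open ≤-Reasoning

⅛ : ℚ
⅛ = + 1 ℚ./ 8

⅛-pos : 0ℚ ℚ.< ⅛
⅛-pos = ℚ.*<* (ℤ.+<+ (s≤s z≤n))

⅛-≤ᵇ-fraction : ∀ a k → suc k ≤ 8 * a → T (⅛ ℚ.≤ᵇ (+ a) ℚ./ suc k)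
⅛-≤ᵇ-fraction a k le = from (≤ᵇ-fraction⇔ ⅛ a k) (from (mkℚᵘ-≤⇔ 1 7 a k) (begin
  1 * suc k  ≡⟨ *-identityˡ (suc k) ⟩
  suc k      ≤⟨ le ⟩
  8 * a      ≡⟨ *-comm 8 a ⟩
  a * 8      ∎))
  where open ≤-Reasoning

count-≤-+ : ∀ A m d → count A m ≤ count A (d + m)
count-≤-+ A m zero    = ≤-refl
count-≤-+ A m (suc d) = ≤-trans (count-≤-+ A m d) (m≤n+m _ _)

count-mono : ∀ A {m n} → m ≤ n → count A m ≤ count A n
count-mono A {m} {n} m≤n = subst (λ x → count A m ≤ count A x) (m∸n+n≡m m≤n) (count-≤-+ A m (n ∸ m))

count-interval : ∀ A t L → (∀ x → t ≤ x → x < L + t → x ∈ A) → L ≤ count A (L + t)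
count-interval A t zero    _      = z≤n
count-interval A t (suc L) inside rewrite inside (L + t) (m≤n+m t L) ≤-refl =
  s≤s (count-interval A t L λ x t≤x x<L+t → inside x t≤x (m<n⇒m<1+n x<L+t))

ascents : (ℕ → ℕ) → Subset
ascents f m = f m <ᵇ f (suc m)

count-ascents-≤ : ∀ f → (∀ m → f m ≤ f (suc m)) → ∀ n → count (ascents f) n ≤ f n
count-ascents-≤ f mono zero = z≤n
count-ascents-≤ f mono (suc n) with f n <ᵇ f (suc n) in ascent
... | true  = ≤-trans (s≤s (count-ascents-≤ f mono n)) (<ᵇ⇒< _ _ (from T-≡ ascent))
... | false = ≤-trans (count-ascents-≤ f mono n) (mono n)

-- block m = ⌊log₂ (m + 1)⌋, the index of the dyadic block [2ʲ, 2ʲ⁺¹) containing the paper's m + 1.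
block : ℕ → ℕ
block zero    = zero
block (suc m) = if 2 ^ suc (block m) ≤ᵇ suc (suc m) then suc (block m) else block m

block-spec : ∀ m → 2 ^ block m ≤ suc m × suc m < 2 ^ suc (block m)
block-spec zero = ≤-refl , s≤s (s≤s z≤n)
block-spec (suc m) with 2 ^ suc (block m) ≤ᵇ suc (suc m) in grows | block-spec m
... | true  | _     , upper = ≤ᵇ⇒≤ (2 ^ suc (block m)) _ (from T-≡ grows) ,
                              ≤-<-trans upper (^-monoʳ-< 2 (s≤s (s≤s z≤n)) (n<1+n (suc (block m))))
... | false | lower , _     = ≤-trans lower (n≤1+n _) , ≰⇒> (λ le → subst T grows (≤⇒≤ᵇ le))

block-mono : ∀ m → block m ≤ block (suc m)
block-mono m with 2 ^ suc (block m) ≤ᵇ suc (suc m)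
... | true  = n≤1+n _
... | false = ≤-refl

exponent-≤ : ∀ {a b y} → 2 ^ a ≤ y → y < 2 ^ suc b → a ≤ b
exponent-≤ 2^a≤y y<2^b+1 = ≮⇒≥ λ b<a → <⇒≱ y<2^b+1 (≤-trans (^-monoʳ-≤ 2 b<a) 2^a≤y)

block-unique : ∀ {m j} → 2 ^ j ≤ suc m → suc m < 2 ^ suc j → block m ≡ j
block-unique {m} 2^j≤ <2^j+1 = ≤-antisym
  (exponent-≤ (proj₁ (block-spec m)) <2^j+1) (exponent-≤ 2^j≤ (proj₂ (block-spec m)))

block⊆⇒count : ∀ A i n → (∀ x → block x ≡ i → x ∈ A) → 2 ^ suc i ≤ suc n → 2 ^ i ≤ count A n
block⊆⇒count A i n block⊆A 2^i+1≤ = ≤-trans (count-interval A start (2 ^ i) inside) (count-mono A end≤n)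
  where
  start : ℕ
  start = pred (2 ^ i)

  suc-start : suc start ≡ 2 ^ i
  suc-start = suc-pred (2 ^ i) {{m^n≢0 2 i}}

  suc-end : suc (2 ^ i + start) ≡ 2 ^ suc i
  suc-end = begin
    suc (2 ^ i + start)  ≡⟨ sym (+-suc (2 ^ i) start) ⟩
    2 ^ i + suc start    ≡⟨ cong (λ x → 2 ^ i + x) suc-start ⟩
    2 ^ i + 2 ^ i        ≡⟨ cong (λ x → 2 ^ i + x) (sym (+-identityʳ (2 ^ i))) ⟩
    2 ^ suc i            ∎
    where open ≡-Reasoning

  inside : ∀ x → start ≤ x → x < 2 ^ i + start → x ∈ A
  inside x start≤x x<end = block⊆A x (block-unique
    (subst (_≤ suc x) suc-start (s≤s start≤x)) (subst (suc x <_) suc-end (s≤s x<end)))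

  end≤n : 2 ^ i + start ≤ n
  end≤n = ≤-pred (subst (_≤ suc n) (sym suc-end) 2^i+1≤)

isEven : ℕ → Bool
isEven zero    = true
isEven (suc n) = not (isEven n)

isEven-either : ∀ i b → isEven i ≡ b ⊎ isEven (suc i) ≡ b
isEven-either i b with isEven i | b
... | true  | true  = inj₁ refl
... | true  | false = inj₂ refl
... | false | true  = inj₂ refl
... | false | false = inj₁ refl

-- Of the two blocks preceding the block of k, one has the required parity and
-- holds at least an eighth of {0, …, k}.
blockParity-density : ∀ A b → (∀ x → isEven (block x) ≡ b → x ∈ A) →
                      ∀ k → 3 ≤ k → suc k ≤ 8 * count A (suc k)
blockParity-density A b parity⊆A k 3≤k with block k | block-spec k
... | zero          | _     , upper = ⊥-elim (<⇒≱ upper (s≤s (≤-trans (s≤s z≤n) 3≤k)))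
... | suc zero      | _     , upper = ⊥-elim (<⇒≱ upper (s≤s 3≤k))
... | suc (suc i)   | lower , upper = begin
  suc k              ≤⟨ <⇒≤ upper ⟩
  2 ^ (3 + i)        ≡⟨ ^-distribˡ-+-* 2 3 i ⟩
  8 * 2 ^ i          ≤⟨ *-monoʳ-≤ 8 sameParityBlock ⟩
  8 * count A (suc k) ∎
  where
  open ≤-Reasoning
  sameParityBlock : 2 ^ i ≤ count A (suc k)
  sameParityBlock with isEven-either i b
  ... | inj₁ even = block⊆⇒count A i (suc k) (λ x eq → parity⊆A x (trans (cong isEven eq) even))
                      (≤-trans (^-monoʳ-≤ 2 (n≤1+n (suc i))) (≤-trans lower (n≤1+n _)))
  ... | inj₂ even = ≤-trans (^-monoʳ-≤ 2 (n≤1+n i))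
                      (block⊆⇒count A (suc i) (suc k) (λ x eq → parity⊆A x (trans (cong isEven eq) even))
                        (≤-trans lower (n≤1+n _)))

HasZeroDensity : Subset → Set
HasZeroDensity A = ∀ q → ∃ λ N → ∀ k → N ≤ k → q * count A (suc k) < suc k

square-≤-2^ : ∀ n → 4 ≤ n → n * n ≤ 2 ^ n
square-≤-2^ n 4≤n with n ∸ 4 | m+[n∸m]≡n 4≤n
... | d | refl = go d
  where
  step : ∀ d → 2 * ((4 + d) * (4 + d)) ≡ (5 + d) * (5 + d) + (d * d + 6 * d + 7)
  step = solve-∀

  go : ∀ d → (4 + d) * (4 + d) ≤ 2 ^ (4 + d)
  go zero    = ≤-refl
  go (suc d) = ≤-trans (m≤m+n _ _) (≤-trans (≤-reflexive (sym (step d))) (*-monoʳ-≤ 2 (go d)))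

*-≤-if-2^-≤ : ∀ q j n → q * (q + 3) ≤ n → 2 ^ j ≤ 2 + n → q * j ≤ n
*-≤-if-2^-≤ q j n q[q+3]≤n 2^j≤ with j ≤? q + 3
... | yes j≤q+3 = ≤-trans (*-monoʳ-≤ q j≤q+3) q[q+3]≤n
... | no  j≰q+3 = +-cancelˡ-≤ 2 _ _ (begin
  2 + q * j      ≤⟨ +-monoˡ-≤ (q * j) (*-monoʳ-≤ 2 (≤-trans (s≤s z≤n) 4≤j)) ⟩
  2 * j + q * j  ≡⟨ sym (*-distribʳ-+ j 2 q) ⟩
  (2 + q) * j    ≤⟨ *-monoˡ-≤ j 2+q≤j ⟩
  j * j          ≤⟨ square-≤-2^ j 4≤j ⟩
  2 ^ j          ≤⟨ 2^j≤ ⟩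
  2 + n          ∎)
  where
  open ≤-Reasoning
  q+4≤j : q + 4 ≤ j
  q+4≤j = subst (_≤ j) (sym (+-suc q 3)) (≰⇒> j≰q+3)
  4≤j : 4 ≤ j
  4≤j = ≤-trans (m≤n+m 4 q) q+4≤j
  2+q≤j : 2 + q ≤ j
  2+q≤j = ≤-trans (≤-reflexive (+-comm 2 q)) (≤-trans (+-monoʳ-≤ q (s≤s (s≤s z≤n))) q+4≤j)

blockEnds : Subset
blockEnds = ascents block

blockEnds-zeroDensity : HasZeroDensity blockEnds
blockEnds-zeroDensity q = q * (q + 3) , λ k N≤k → s≤s (begin
  q * count blockEnds (suc k)       ≤⟨ *-monoʳ-≤ q (count-ascents-≤ block block-mono (suc k)) ⟩
  q * block (suc k)                 ≤⟨ *-≤-if-2^-≤ q (block (suc k)) k N≤k (proj₁ (block-spec (suc k))) ⟩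
  k                                 ∎)
  where open ≤-Reasoning

module _ {J : Family} (J-ideal : IsIdeal J) where

  open Ideal J-ideal

  zeroDensity⇒Zδ : ∀ A → HasZeroDensity A → Zδ J A
  zeroDensity⇒Zδ A sparse ε ε>0 with ≤ᵇ-fraction⇒ ε ε>0
  ... | q , large⇒ with sparse q
  ...   | N , small = finite _ (N , λ k h → ≰⇒> λ N≤k → <⇒≱ (small k N≤k) (large⇒ _ k (from T-≡ h)))

  ⅛-lowerDensity⇒¬Zδ : ∀ A → (∀ k → 3 ≤ k → suc k ≤ 8 * count A (suc k)) → ¬ Zδ J A
  ⅛-lowerDensity⇒¬Zδ A dense A∈Zδ =
    ¬Full (⊆-closed cover (∪-closed _ _ (A∈Zδ ⅛ ⅛-pos) (finite _ (3 , λ m h → <ᵇ⇒< m 3 (from T-≡ h)))))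
    where
    cover : Full ⊆ ((λ k → ⅛ ℚ.≤ᵇ dens A k) ∪ (λ k → k <ᵇ 3))
    cover m _ with m <? 3
    ... | yes m<3 = ∨-introʳ (to T-≡ (<⇒<ᵇ m<3))
    ... | no  m≮3 = ∨-introˡ (to T-≡ (⅛-≤ᵇ-fraction (count A (suc m)) m (dense m (≮⇒≥ m≮3))))

evenBlocks : Subset
evenBlocks m = isEven (block m)

evenBlocks-changes : ∀ m → evenBlocks m ≢ evenBlocks (suc m) → m ∈ blockEnds
evenBlocks-changes m change = to T-≡ (<⇒<ᵇ (≤∧≢⇒< (block-mono m) (λ eq → change (cong isEven eq))))

theorem3p14 : (J : Family) → IsMaximalIdeal J → ¬ IsTMaximal (Zδ J)
theorem3p14 J (J-ideal , _) Zδ-TMaximal@(Zδ-ideal , _) =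
  ¬IsTMaximal-if-almostInvariant evenBlocks
    (⅛-lowerDensity⇒¬Zδ J-ideal evenBlocks (blockParity-density evenBlocks true λ _ even → even))
    (⅛-lowerDensity⇒¬Zδ J-ideal (∁ evenBlocks) (blockParity-density (∁ evenBlocks) false λ _ odd → cong not odd))
    (TIIdeal.almostInvariant Zδ-ideal evenBlocks blockEnds
      (zeroDensity⇒Zδ J-ideal blockEnds blockEnds-zeroDensity) evenBlocks-changes)
    Zδ-TMaximal
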